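{- Let $n\geq 3$ and let $k$ be an odd integer with $3\leq k\leq 2^{n-1}$. Then $\kappa^s(Q_n;C_k)=\lceil\frac{2n}{k+1}\rceil$.
   Context: $Q_n$ is the $n$-dimensional hypercube: its vertices are the binary strings of length $n$, two vertices being adjacent iff they differ in exactly one position. $C_k$ denotes the cycle of length $k$. For connected graphs $G,H$, an $H$-substructure cut of $G$ is a set $F$ of subgraphs of $G$, each isomorphic to a connected subgraph of $H$, such that $G-V(F)$ is disconnected or trivial (a single vertex); $\kappa^s(G;H)$ is the minimum cardinality of an $H$-substructure cut of $G$. -}

module Defs where

open import Data.Nat using (ℕ; zero; suc; _+_; _*_; _≤_; _/_)
open import Data.Bool using (Bool; true; false)
open import Data.Vec using (Vec; []; _∷_)
open import Data.Fin using (Fin; toℕ)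
open import Data.List using (List; length)
open import Data.List.Membership.Propositional using (_∈_)
open import Data.Product using (Σ; ∃; _×_; _,_)
open import Data.Sum using (_⊎_)
open import Relation.Nullary using (¬_)
open import Relation.Binary.PropositionalEquality using (_≡_)
open import Relation.Binary.Construct.Closure.ReflexiveTransitive using (Star)
open import Relation.Binary.Construct.Closure.Symmetric using (SymClosure)
open import Function.Definitions using (Injective)

QVertex : ℕ → Set
QVertex n = Vec Bool n

hamming : ∀ {n} → QVertex n → QVertex n → ℕ
hamming []       []       = 0
hamming (true  ∷ u) (true  ∷ v) = hamming u v
hamming (false ∷ u) (false ∷ v) = hamming u v
hamming (true  ∷ u) (false ∷ v) = suc (hamming u v)
hamming (false ∷ u) (true  ∷ v) = suc (hamming u v)

QAdj : ∀ {n} → QVertex n → QVertex n → Set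
QAdj u v = hamming u v ≡ 1

CycStep : (k : ℕ) → Fin k → Fin k → Set
CycStep k i j = (suc (toℕ i) ≡ toℕ j) ⊎ ((suc (toℕ i) ≡ k) × (toℕ j ≡ 0))

CycAdj : (k : ℕ) → Fin k → Fin k → Set
CycAdj k i j = CycStep k i j ⊎ CycStep k j i

-- A C_k-substructure of Q_n: a subgraph T of Q_n (m distinct vertices,
-- an edge relation on them whose edges are edges of Q_n) which is
-- connected and isomorphic to a (connected) subgraph of C_k, i.e. admits
-- an injective graph homomorphism into C_k (its image, with the image
-- edges, is the subgraph of C_k isomorphic to T).

record CSub (n k : ℕ) : Set₁ where
  field
    m        : ℕ
    vert     : Fin m → QVertex n
    vert-inj : Injective _≡_ _≡_ vert
    edge     : Fin m → Fin m → Set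
    edge-sub : ∀ i j → edge i j → QAdj (vert i) (vert j)
    conn     : ∀ i j → Star (SymClosure edge) i j
    emb      : Fin m → Fin k
    emb-inj  : Injective _≡_ _≡_ emb
    emb-hom  : ∀ i j → edge i j → CycAdj k (emb i) (emb j)

open CSub public

Removed : ∀ {n k} → List (CSub n k) → QVertex n → Set₁
Removed F v = ∃ λ T → (T ∈ F) × Σ (Fin (m T)) (λ i → vert T i ≡ v)

RemAdj : ∀ {n k} → List (CSub n k) → QVertex n → QVertex n → Set₁
RemAdj F u v = QAdj u v × ¬ Removed F u × ¬ Removed F v

RemDisconnected : ∀ {n k} → List (CSub n k) → Set₁
RemDisconnected {n} F =
  Σ (QVertex n) λ u → Σ (QVertex n) λ v →
    ¬ Removed F u × ¬ Removed F v × ¬ Star (RemAdj F) u v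

RemTrivial : ∀ {n k} → List (CSub n k) → Set₁
RemTrivial {n} F =
  Σ (QVertex n) λ u → ¬ Removed F u × (∀ v → ¬ Removed F v → v ≡ u)

IsCut : ∀ {n k} → List (CSub n k) → Set₁
IsCut F = RemDisconnected F ⊎ RemTrivial F

KappaS≡ : (n k c : ℕ) → Set₁
KappaS≡ n k c =
  (Σ (List (CSub n k)) λ F → IsCut F × length F ≡ c) ×
  (∀ (F : List (CSub n k)) → IsCut F → c ≤ length F)

-- ⌈ a / (b+1) ⌉
ceilDivSuc : ℕ → ℕ → ℕ
ceilDivSuc a b = (a + b) / suc b

module Submission where

-- Write k = 2j + 1, so that ⌈2n/(k+1)⌉ = ⌈n/(j+1)⌉.
--
-- Upper bound: the zigzag path e₀, e₀+e₁, e₁, e₁+e₂, … through the vertices of weight 1 and 2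
-- is covered by ⌈n/(j+1)⌉ segments of at most k vertices, each starting at some e_a and passing
-- through e_a, …, e_(a+j) while these exist. Deleting them removes every neighbour of 0…0 but
-- neither 0…0 nor 1…1.
--
-- Lower bound: colour Q_n by the parity of the distance to a vertex w. A C_k-substructure T is
-- properly coloured, and since C_k is an odd cycle some cycle edge does not change colour; opening
-- the cycle there, colours alternate along T. The neighbours of w share a colour, so T contains at
-- most j+1 of them. Hence fewer than ⌈n/(j+1)⌉ substructures leave every vertex a surviving
-- neighbour and delete at most 2n−3 vertices, and such a deletion leaves Q_n connected: one half
-- Q_(n-1) loses at most n−2 vertices and stays connected, and a counting argument on
-- second neighbourhoods lets every surviving vertex of the other half cross over.

open import Defs
open import Data.Nat
  using (ℕ; zero; suc; _+_; _*_; _∸_; _^_; _≤_; _<_; z≤n; s≤s; z<s; _<?_; _≤?_; _≟_; >-nonZero; _⊓_; ⌊_/2⌋; parity)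
open import Data.Nat.Properties
open import Data.Nat.DivMod using (_/_; _%_; m≡m%n+[m/n]*n; m%n<n; m/n*n≤m; m<n*o⇒m/o<n)
open import Data.Nat.Tactic.RingSolver using (solve-∀)
open import Algebra.Properties.CommutativeSemigroup +-commutativeSemigroup using (interchange)
open import Data.Parity.Base as ℙ using (Parity; 0ℙ; 1ℙ; _⁻¹)
open import Data.Parity.Properties using (suc-homo-⁻¹; ⁻¹-selfInverse; ⁻¹-involutive; p≢p⁻¹; *-homo-*)
  renaming (_≟_ to _≟ℙ_; +-cancelʳ-≡ to +ℙ-cancelʳ-≡)
open import Data.Bool using (Bool; true; false; not)
open import Data.Bool.Properties using (not-¬; ¬-not) renaming (_≟_ to _≟ᵇ_)
open import Data.Vec using ([]; _∷_; replicate; head; tail)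
open import Data.Vec.Properties using (≡-dec)
open import Data.Fin using (Fin; toℕ; fromℕ<; punchIn; splitAt; join; combine; inject≤)
  renaming (zero to fzero; suc to fsuc)
open import Data.Fin.Properties
  using (toℕ<n; toℕ-injective; toℕ-fromℕ<; fromℕ<-toℕ; toℕ-inject≤; inject≤-injective; any?; all?; ¬∀⟶∃¬;
         injective⇒≤; punchIn-injective; punchInᵢ≢i; join-splitAt; combine-injective)
open import Data.List using (List; []; _∷_; length; lookup; tabulate; _++_)
open import Data.List.Properties using (length-++; length-tabulate)
open import Data.List.Membership.Propositional using (_∈_; _∉_)
open import Data.List.Membership.Propositional.Properties
  using (∈-tabulate⁺; ∈-tabulate⁻; ∈-++⁺ˡ; ∈-++⁺ʳ; ∈-++⁻)
import Data.List.Membership.DecPropositional as DecMembership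
open import Data.List.Relation.Unary.Any using (here; there; index)
open import Data.List.Relation.Unary.Any.Properties using (lookup-index)
open import Data.Product using (Σ; ∃; _×_; _,_; proj₁; proj₂)
open import Data.Sum using (_⊎_; inj₁; inj₂)
open import Data.Empty using (⊥-elim)
open import Function using (_∘_; id)
open import Function.Definitions using (Injective)
open import Relation.Nullary using (¬_; Dec; yes; no)
open import Relation.Nullary.Decidable using (¬?; _×-dec_; _⊎-dec_; decidable-stable)
open import Relation.Binary.PropositionalEquality
open import Relation.Binary.Construct.Closure.ReflexiveTransitive using (Star; ε; _◅_; _◅◅_; reverse; gmap)
open import Relation.Binary.Construct.Closure.Symmetric using (SymClosure; fwd; bwd; symmetric)

hamming-refl : ∀ {n} (x : QVertex n) → hamming x x ≡ 0
hamming-refl []          = refl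
hamming-refl (true  ∷ x) = hamming-refl x
hamming-refl (false ∷ x) = hamming-refl x

hamming-sym : ∀ {n} (x y : QVertex n) → hamming x y ≡ hamming y x
hamming-sym []          []          = refl
hamming-sym (true  ∷ x) (true  ∷ y) = hamming-sym x y
hamming-sym (true  ∷ x) (false ∷ y) = cong suc (hamming-sym x y)
hamming-sym (false ∷ x) (true  ∷ y) = cong suc (hamming-sym x y)
hamming-sym (false ∷ x) (false ∷ y) = hamming-sym x y

hamming-∷ : ∀ {n} b (x y : QVertex n) → hamming (b ∷ x) (b ∷ y) ≡ hamming x y
hamming-∷ true  x y = refl
hamming-∷ false x y = refl

hamming≡0⇒≡ : ∀ {n} (x y : QVertex n) → hamming x y ≡ 0 → x ≡ y
hamming≡0⇒≡ []          []          _ = refl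
hamming≡0⇒≡ (true  ∷ x) (true  ∷ y) h = cong (true ∷_) (hamming≡0⇒≡ x y h)
hamming≡0⇒≡ (false ∷ x) (false ∷ y) h = cong (false ∷_) (hamming≡0⇒≡ x y h)

flip : ∀ {n} → Fin n → QVertex n → QVertex n
flip fzero    (b ∷ x) = not b ∷ x
flip (fsuc i) (b ∷ x) = b ∷ flip i x

hamming-flip : ∀ {n} i (x : QVertex n) → hamming (flip i x) x ≡ 1
hamming-flip fzero    (true  ∷ x) = cong suc (hamming-refl x)
hamming-flip fzero    (false ∷ x) = cong suc (hamming-refl x)
hamming-flip (fsuc i) (b ∷ x)     = trans (hamming-∷ b (flip i x) x) (hamming-flip i x)

flip-adjacent : ∀ {n} i (x : QVertex n) → QAdj x (flip i x)
flip-adjacent i x = trans (hamming-sym x (flip i x)) (hamming-flip i x)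

flip-injective : ∀ {n} {i j} (x : QVertex n) → flip i x ≡ flip j x → i ≡ j
flip-injective {i = fzero}  {fzero}  (b ∷ x) _ = refl
flip-injective {i = fzero}  {fsuc j} (b ∷ x) e = ⊥-elim (not-¬ refl (sym (cong head e)))
flip-injective {i = fsuc i} {fzero}  (b ∷ x) e = ⊥-elim (not-¬ refl (cong head e))
flip-injective {i = fsuc i} {fsuc j} (b ∷ x) e = cong fsuc (flip-injective x (cong tail e))

hamming-flip-flip : ∀ {n} {i j} (x : QVertex n) → i ≢ j → hamming (flip i (flip j x)) x ≡ 2
hamming-flip-flip {i = fzero}  {fzero}  x       i≢j = ⊥-elim (i≢j refl)
hamming-flip-flip {i = fzero}  {fsuc j} (true  ∷ x) _ = cong suc (hamming-flip j x)
hamming-flip-flip {i = fzero}  {fsuc j} (false ∷ x) _ = cong suc (hamming-flip j x)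
hamming-flip-flip {i = fsuc i} {fzero}  (true  ∷ x) _ = cong suc (hamming-flip i x)
hamming-flip-flip {i = fsuc i} {fzero}  (false ∷ x) _ = cong suc (hamming-flip i x)
hamming-flip-flip {i = fsuc i} {fsuc j} (b ∷ x) i≢j =
  trans (hamming-∷ b _ x) (hamming-flip-flip x (i≢j ∘ cong fsuc))

≢-by-distance : ∀ {n} {u v : QVertex n} w {a b} → hamming u w ≡ a → hamming v w ≡ b → a ≢ b → u ≢ v
≢-by-distance w uw≡a vw≡b a≢b refl = a≢b (trans (sym uw≡a) vw≡b)

adjacent⇒flip : ∀ {n} (x y : QVertex n) → QAdj x y → ∃ λ i → y ≡ flip i x
adjacent⇒flip []          []          ()
adjacent⇒flip (true  ∷ x) (true  ∷ y) h = let i , e = adjacent⇒flip x y h in fsuc i , cong (true ∷_) e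
adjacent⇒flip (false ∷ x) (false ∷ y) h = let i , e = adjacent⇒flip x y h in fsuc i , cong (false ∷_) e
adjacent⇒flip (true  ∷ x) (false ∷ y) h = fzero , cong (false ∷_) (sym (hamming≡0⇒≡ x y (suc-injective h)))
adjacent⇒flip (false ∷ x) (true  ∷ y) h = fzero , cong (true ∷_) (sym (hamming≡0⇒≡ x y (suc-injective h)))

parity-suc : ∀ n → parity (suc n) ≡ parity n ⁻¹
parity-suc n = sym (⁻¹-selfInverse (suc-homo-⁻¹ n))

opposite-parity-suc : ∀ a b → parity a ≡ parity b ⁻¹ → parity (suc a) ≡ parity (suc b) ⁻¹
opposite-parity-suc a b e = trans (parity-suc a) (cong _⁻¹ (trans e (sym (parity-suc b))))

parity-flip : ∀ {n} i (x w : QVertex n) → parity (hamming (flip i x) w) ≡ parity (hamming x w) ⁻¹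
parity-flip fzero    (true  ∷ x) (true  ∷ w) = parity-suc (hamming x w)
parity-flip fzero    (false ∷ x) (false ∷ w) = parity-suc (hamming x w)
parity-flip fzero    (true  ∷ x) (false ∷ w) = sym (suc-homo-⁻¹ (hamming x w))
parity-flip fzero    (false ∷ x) (true  ∷ w) = sym (suc-homo-⁻¹ (hamming x w))
parity-flip (fsuc i) (true  ∷ x) (true  ∷ w) = parity-flip i x w
parity-flip (fsuc i) (false ∷ x) (false ∷ w) = parity-flip i x w
parity-flip (fsuc i) (true  ∷ x) (false ∷ w) = opposite-parity-suc (hamming (flip i x) w) (hamming x w) (parity-flip i x w)
parity-flip (fsuc i) (false ∷ x) (true  ∷ w) = opposite-parity-suc (hamming (flip i x) w) (hamming x w) (parity-flip i x w)

adjacent-parity : ∀ {n} (x y w : QVertex n) → QAdj x y → parity (hamming y w) ≡ parity (hamming x w) ⁻¹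
adjacent-parity x y w x~y with adjacent⇒flip x y x~y
... | i , refl = parity-flip i x w

-- Properly 2-coloured substructures of an odd cycle

⁻¹-+ : ∀ p q → p ⁻¹ ℙ.+ q ≡ (p ℙ.+ q) ⁻¹
⁻¹-+ 0ℙ q = refl
⁻¹-+ 1ℙ q = sym (⁻¹-involutive q)

⁻¹-+-⁻¹ : ∀ p q → p ⁻¹ ℙ.+ q ⁻¹ ≡ p ℙ.+ q
⁻¹-+-⁻¹ 0ℙ 0ℙ = refl
⁻¹-+-⁻¹ 0ℙ 1ℙ = refl
⁻¹-+-⁻¹ 1ℙ 0ℙ = refl
⁻¹-+-⁻¹ 1ℙ 1ℙ = refl

parity-⌊/2⌋-injective : ∀ {a b} → parity a ≡ parity b → ⌊ a /2⌋ ≡ ⌊ b /2⌋ → a ≡ b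
parity-⌊/2⌋-injective {zero}        {zero}        _ _ = refl
parity-⌊/2⌋-injective {suc zero}    {suc zero}    _ _ = refl
parity-⌊/2⌋-injective {suc (suc a)} {suc (suc b)} p h =
  cong (suc ∘ suc) (parity-⌊/2⌋-injective p (suc-injective h))
parity-⌊/2⌋-injective {zero}        {suc zero}    () _
parity-⌊/2⌋-injective {suc zero}    {zero}        () _
parity-⌊/2⌋-injective {zero}        {suc (suc b)} _ ()
parity-⌊/2⌋-injective {suc zero}    {suc (suc b)} _ ()
parity-⌊/2⌋-injective {suc (suc a)} {zero}        _ ()
parity-⌊/2⌋-injective {suc (suc a)} {suc zero}    _ ()

2*j+1≡1+[j+j] : ∀ j → 2 * j + 1 ≡ suc (j + j)
2*j+1≡1+[j+j] j = trans (+-comm (2 * j) 1) (cong (λ t → suc (j + t)) (+-identityʳ j))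

⌊/2⌋-< : ∀ {a} j → a < 2 * j + 1 → ⌊ a /2⌋ < suc j
⌊/2⌋-< {a} j a<K =
  s≤s (≤-trans (⌊n/2⌋-mono (≤-pred (≤-trans a<K (≤-reflexive (2*j+1≡1+[j+j] j)))))
               (≤-reflexive (sym (n≡⌊n+n/2⌋ j))))

CycSucc : ℕ → ℕ → ℕ → Set
CycSucc K a b = suc a ≡ b ⊎ (suc a ≡ K × b ≡ 0)

cycSucc? : ∀ K a b → Dec (CycSucc K a b)
cycSucc? K a b = (suc a ≟ b) ⊎-dec ((suc a ≟ K) ×-dec (b ≟ 0))

-- The position of a on the K-cycle when counting starts at x₀ + 1.
rotate : ℕ → ℕ → ℕ → ℕ
rotate K x₀ a with x₀ <? a
... | yes _ = a ∸ suc x₀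
... | no  _ = a + K ∸ suc x₀

rotate-< : ∀ {K x₀ a} → x₀ < K → a < K → rotate K x₀ a < K
rotate-< {K} {x₀} {a} x₀<K a<K with x₀ <? a
... | yes _   = ≤-<-trans (m∸n≤m a (suc x₀)) a<K
... | no  x₀≮a = m<n+o⇒m∸n<o (a + K) (suc x₀) {{>-nonZero (≤-<-trans z≤n x₀<K)}}
                   (+-monoˡ-< K (s≤s (≮⇒≥ x₀≮a)))

rotate-injective : ∀ {K x₀ a b} → x₀ < K → a < K → b < K → rotate K x₀ a ≡ rotate K x₀ b → a ≡ b
rotate-injective {K} {x₀} {a} {b} x₀<K a<K b<K e with x₀ <? a | x₀ <? b
... | yes x₀<a | yes x₀<b = ∸-cancelʳ-≡ x₀<a x₀<b e
... | no  _    | no  _    =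
  +-cancelʳ-≡ K a b (∸-cancelʳ-≡ (≤-trans x₀<K (m≤n+m K a)) (≤-trans x₀<K (m≤n+m K b)) e)
... | yes x₀<a | no  _    =
  ⊥-elim (<-irrefl e (<-≤-trans (∸-monoˡ-< a<K x₀<a) (∸-monoˡ-≤ (suc x₀) (m≤n+m K b))))
... | no  _    | yes x₀<b =
  ⊥-elim (<-irrefl (sym e) (<-≤-trans (∸-monoˡ-< b<K x₀<b) (∸-monoˡ-≤ (suc x₀) (m≤n+m K a))))

rotate-succ : ∀ {K x₀ a b} → x₀ < K → a ≢ x₀ → CycSucc K a b → rotate K x₀ b ≡ suc (rotate K x₀ a)
rotate-succ {K} {x₀} {a} x₀<K a≢x₀ (inj₁ refl) with x₀ <? a | x₀ <? suc a
... | yes x₀<a | yes _     = +-∸-assoc 1 x₀<a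
... | yes x₀<a | no  x₀≮a+1 = ⊥-elim (x₀≮a+1 (m<n⇒m<1+n x₀<a))
... | no  x₀≮a | yes x₀<a+1 = ⊥-elim (a≢x₀ (≤-antisym (≮⇒≥ x₀≮a) (≤-pred x₀<a+1)))
... | no  _    | no  _      = +-∸-assoc 1 (≤-trans x₀<K (m≤n+m K a))
rotate-succ {K} {x₀} {a} x₀<K a≢x₀ (inj₂ (a+1≡K , refl)) with x₀ <? a | x₀ <? 0
... | yes x₀<a | no _ = trans (cong (_∸ suc x₀) (sym a+1≡K)) (+-∸-assoc 1 x₀<a)
... | no  x₀≮a | no _ =
  ⊥-elim (a≢x₀ (≤-antisym (≮⇒≥ x₀≮a) (≤-pred (≤-trans x₀<K (≤-reflexive (sym a+1≡K))))))

module _ {n j} (T : CSub n (2 * j + 1)) (colour : Fin (m T) → Parity)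
         (proper : ∀ {x y} → edge T x y → colour y ≡ colour x ⁻¹) where

  private
    K : ℕ
    K = 2 * j + 1

    pos : Fin (m T) → ℕ
    pos x = toℕ (emb T x)

    pos<K : ∀ x → pos x < K
    pos<K x = toℕ<n (emb T x)

    pos-injective : ∀ {x y} → pos x ≡ pos y → x ≡ y
    pos-injective = emb-inj T ∘ toℕ-injective

    2j<K : 2 * j < K
    2j<K = m<m+n (2 * j) z<s

    ColourChangeAt : ℕ → Set
    ColourChangeAt x₀ = ∃ λ p → ∃ λ q → pos p ≡ x₀ × CycSucc K x₀ (pos q) × colour q ≡ colour p ⁻¹

    colourChangeAt? : ∀ x₀ → Dec (ColourChangeAt x₀)
    colourChangeAt? x₀ = any? λ p → any? λ q →
      (pos p ≟ x₀) ×-dec cycSucc? K x₀ (pos q) ×-dec (colour q ≟ℙ colour p ⁻¹)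

    alternating : (∀ x → x < K → ColourChangeAt x) → ∀ {p₀} → pos p₀ ≡ 0 →
                  ∀ x → x < K → ∀ p → pos p ≡ x → colour p ≡ parity x ℙ.+ colour p₀
    alternating change p₀≡0 zero    _     p p≡0   = cong colour (pos-injective (trans p≡0 (sym p₀≡0)))
    alternating change {p₀} p₀≡0 (suc x) x+1<K p p≡x+1 with change x (<-trans (n<1+n x) x+1<K)
    ... | _ , _ , _ , inj₂ (x+1≡K , _) , _ = ⊥-elim (<-irrefl x+1≡K x+1<K)
    ... | p′ , q′ , p′≡x , inj₁ x+1≡q′ , q′≡p′⁻¹ = begin
      colour p                     ≡⟨ cong colour (pos-injective (trans p≡x+1 x+1≡q′)) ⟩
      colour q′                    ≡⟨ q′≡p′⁻¹ ⟩
      colour p′ ⁻¹                 ≡⟨ cong _⁻¹ (alternating change p₀≡0 x x<K p′ p′≡x) ⟩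
      (parity x ℙ.+ colour p₀) ⁻¹  ≡⟨ ⁻¹-+ (parity x) (colour p₀) ⟨
      parity x ⁻¹ ℙ.+ colour p₀    ≡⟨ cong (ℙ._+ colour p₀) (parity-suc x) ⟨
      parity (suc x) ℙ.+ colour p₀ ∎
      where
      open ≡-Reasoning
      x<K : x < K
      x<K = <-trans (n<1+n x) x+1<K

    odd-cycle-not-alternating : ¬ (∀ x → x < K → ColourChangeAt x)
    odd-cycle-not-alternating change with change 0 (≤-<-trans z≤n 2j<K) | change (2 * j) 2j<K
    ... | _ | _ , q , _ , inj₁ 2j+1≡q , _ =
      <-irrefl refl (subst₂ _<_ (sym 2j+1≡q) (+-comm (2 * j) 1) (pos<K q))
    ... | p₀ , _ , p₀≡0 , _ | p , q , p≡2j , inj₂ (_ , q≡0) , q≡p⁻¹ = p≢p⁻¹ (colour p₀) (begin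
      colour p₀                          ≡⟨ cong colour (pos-injective (trans p₀≡0 (sym q≡0))) ⟩
      colour q                           ≡⟨ q≡p⁻¹ ⟩
      colour p ⁻¹                        ≡⟨ cong _⁻¹ (alternating change p₀≡0 (2 * j) 2j<K p p≡2j) ⟩
      (parity (2 * j) ℙ.+ colour p₀) ⁻¹  ≡⟨ cong (λ t → (t ℙ.+ colour p₀) ⁻¹) (*-homo-* 2 j) ⟩
      colour p₀ ⁻¹                       ∎)
      where open ≡-Reasoning

    module OpenedAfter {x₀} (x₀<K : x₀ < K) (no-change : ¬ ColourChangeAt x₀) where

      rank : Fin (m T) → ℕ
      rank x = rotate K x₀ (pos x)

      -- No edge of T crosses the cycle edge after x₀, so along T the rank grows by one per edge.
      invariant : Fin (m T) → Parity
      invariant x = parity (rank x) ℙ.+ colour x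

      invariant-succ : ∀ {x y} → colour y ≡ colour x ⁻¹ → CycSucc K (pos x) (pos y) → invariant x ≡ invariant y
      invariant-succ {x} {y} y≡x⁻¹ step = begin
        parity (rank x) ℙ.+ colour x          ≡⟨ ⁻¹-+-⁻¹ (parity (rank x)) (colour x) ⟨
        parity (rank x) ⁻¹ ℙ.+ colour x ⁻¹    ≡⟨ cong₂ ℙ._+_ (parity-suc (rank x)) y≡x⁻¹ ⟨
        parity (suc (rank x)) ℙ.+ colour y    ≡⟨ cong (λ r → parity r ℙ.+ colour y) (rotate-succ x₀<K x≢x₀ step) ⟨
        parity (rank y) ℙ.+ colour y          ∎
        where
        open ≡-Reasoning
        x≢x₀ : pos x ≢ x₀
        x≢x₀ e = no-change (x , y , e , subst (λ t → CycSucc K t (pos y)) e step , y≡x⁻¹)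

      invariant-edge : ∀ {x y} → edge T x y → invariant x ≡ invariant y
      invariant-edge {x} {y} e with emb-hom T x y e
      ... | inj₁ step = invariant-succ (proper e) step
      ... | inj₂ step = sym (invariant-succ (sym (⁻¹-selfInverse (sym (proper e)))) step)

      invariant-constant : ∀ {x y} → Star (SymClosure (edge T)) x y → invariant x ≡ invariant y
      invariant-constant ε            = refl
      invariant-constant (fwd e ◅ es) = trans (invariant-edge e) (invariant-constant es)
      invariant-constant (bwd e ◅ es) = trans (sym (invariant-edge e)) (invariant-constant es)

      half-rank : Fin (m T) → Fin (suc j)
      half-rank x = fromℕ< (⌊/2⌋-< j (rotate-< x₀<K (pos<K x)))

      half-rank-injective : ∀ {x y} → colour x ≡ colour y → half-rank x ≡ half-rank y → x ≡ y
      half-rank-injective {x} {y} x≡y ix≡iy = pos-injective (rotate-injective x₀<K (pos<K x) (pos<K y)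
        (parity-⌊/2⌋-injective same-parity same-half))
        where
        same-parity : parity (rank x) ≡ parity (rank y)
        same-parity = +ℙ-cancelʳ-≡ (colour y) _ _
          (trans (cong (parity (rank x) ℙ.+_) (sym x≡y)) (invariant-constant (conn T x y)))
        same-half : ⌊ rank x /2⌋ ≡ ⌊ rank y /2⌋
        same-half = trans (sym (toℕ-fromℕ< _)) (trans (cong toℕ ix≡iy) (toℕ-fromℕ< _))

  colour-class-index : Σ (Fin (m T) → Fin (suc j)) λ ψ → ∀ {x y} → colour x ≡ colour y → ψ x ≡ ψ y → x ≡ y
  colour-class-index with all? (colourChangeAt? ∘ toℕ {K})
  ... | yes change = ⊥-elim (odd-cycle-not-alternating λ x x<K →
                       subst ColourChangeAt (toℕ-fromℕ< x<K) (change (fromℕ< x<K)))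
  ... | no ¬change with ¬∀⟶∃¬ K (ColourChangeAt ∘ toℕ) (colourChangeAt? ∘ toℕ) ¬change
  ...   | x₀ , no-change = half-rank , half-rank-injective
    where open OpenedAfter (toℕ<n x₀) no-change

-- Connectivity of Q_n after deleting few vertices

_∈?_ : ∀ {n} (x : QVertex n) (xs : List (QVertex n)) → Dec (x ∈ xs)
x ∈? xs = DecMembership._∈?_ (≡-dec _≟ᵇ_) x xs

injection⇒≤length : ∀ {a} {A : Set a} {k} {xs : List A} (f : Fin k → A) →
                    Injective _≡_ _≡_ f → (∀ i → f i ∈ xs) → k ≤ length xs
injection⇒≤length {xs = xs} f f-inj f∈xs = injective⇒≤ {f = index ∘ f∈xs} λ {i} {i′} e →
  f-inj (trans (lookup-index (f∈xs i)) (trans (cong (lookup xs) e) (sym (lookup-index (f∈xs i′)))))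

Edge : ∀ {n} → List (QVertex n) → QVertex n → QVertex n → Set
Edge L u v = QAdj u v × u ∉ L × v ∉ L

Walk : ∀ {n} → List (QVertex n) → QVertex n → QVertex n → Set
Walk L = Star (Edge L)

Connected : ∀ {n} → List (QVertex n) → Set
Connected L = ∀ {u v} → u ∉ L → v ∉ L → Walk L u v

flip-edge : ∀ {n} {L : List (QVertex n)} {x} i → x ∉ L → flip i x ∉ L → Edge L x (flip i x)
flip-edge {x = x} i x∉L fx∉L = flip-adjacent i x , x∉L , fx∉L

walk-reverse : ∀ {n} {L : List (QVertex n)} {u v} → Walk L u v → Walk L v u
walk-reverse = reverse λ {u} {v} (u~v , u∉L , v∉L) → trans (hamming-sym v u) u~v , v∉L , u∉L

connected-Q₀ : (L : List (QVertex 0)) → Connected L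
connected-Q₀ L {[]} {[]} _ _ = ε

slice : ∀ {n} → Bool → List (QVertex (suc n)) → List (QVertex n)
slice b     []                 = []
slice true  ((true  ∷ x) ∷ L) = x ∷ slice true L
slice true  ((false ∷ x) ∷ L) = slice true L
slice false ((false ∷ x) ∷ L) = x ∷ slice false L
slice false ((true  ∷ x) ∷ L) = slice false L

∈-slice⁻ : ∀ {n} b {x : QVertex n} L → x ∈ slice b L → (b ∷ x) ∈ L
∈-slice⁻ true  ((true  ∷ y) ∷ L) (here refl) = here refl
∈-slice⁻ true  ((true  ∷ y) ∷ L) (there p)   = there (∈-slice⁻ true L p)
∈-slice⁻ true  ((false ∷ y) ∷ L) p           = there (∈-slice⁻ true L p)
∈-slice⁻ false ((false ∷ y) ∷ L) (here refl) = here refl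
∈-slice⁻ false ((false ∷ y) ∷ L) (there p)   = there (∈-slice⁻ false L p)
∈-slice⁻ false ((true  ∷ y) ∷ L) p           = there (∈-slice⁻ false L p)

∈-slice⁺ : ∀ {n} b {x : QVertex n} L → (b ∷ x) ∈ L → x ∈ slice b L
∈-slice⁺ true  ((true  ∷ y) ∷ L) (here refl) = here refl
∈-slice⁺ false ((false ∷ y) ∷ L) (here refl) = here refl
∈-slice⁺ true  ((true  ∷ y) ∷ L) (there p)   = there (∈-slice⁺ true L p)
∈-slice⁺ true  ((false ∷ y) ∷ L) (there p)   = ∈-slice⁺ true L p
∈-slice⁺ false ((false ∷ y) ∷ L) (there p)   = there (∈-slice⁺ false L p)
∈-slice⁺ false ((true  ∷ y) ∷ L) (there p)   = ∈-slice⁺ false L p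

length-slices : ∀ {n} (L : List (QVertex (suc n))) → length (slice false L) + length (slice true L) ≡ length L
length-slices []                = refl
length-slices ((true  ∷ x) ∷ L) = trans (+-suc _ _) (cong suc (length-slices L))
length-slices ((false ∷ x) ∷ L) = cong suc (length-slices L)

shorter-slice : ∀ {n m} (L : List (QVertex (suc n))) → length L < suc m + suc m → ∃ λ c → length (slice c L) ≤ m
shorter-slice {m = m} L |L|< with length (slice false L) ≤? m
... | yes short = false , short
... | no  long  = true , ≤-pred (+-cancelˡ-< (suc m) _ _
      (≤-<-trans (+-monoˡ-≤ (length (slice true L)) (≰⇒> long))
                 (subst (_< suc m + suc m) (sym (length-slices L)) |L|<)))

walk-slice : ∀ {n} b {L : List (QVertex (suc n))} {x y} → Walk (slice b L) x y → Walk L (b ∷ x) (b ∷ y)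
walk-slice b {L} = gmap (b ∷_) λ {x} {y} (x~y , x∉ , y∉) →
  trans (hamming-∷ b x y) x~y , x∉ ∘ ∈-slice⁺ b L , y∉ ∘ ∈-slice⁺ b L

ReachesOtherHalf : ∀ {n} → List (QVertex (suc n)) → Set
ReachesOtherHalf L =
  ∀ {b y} → (b ∷ y) ∉ L → ∃ λ y′ → (not b ∷ y′) ∉ L × Walk L (b ∷ y) (not b ∷ y′)

connected-by-halves : ∀ {n} {L : List (QVertex (suc n))} c →
                      Connected (slice c L) → ReachesOtherHalf L → Connected L
connected-by-halves {L = L} c half-connected reach u∉L v∉L with into-half u∉L | into-half v∉L
  where
  into-half : ∀ {u} → u ∉ L → ∃ λ y → (c ∷ y) ∉ L × Walk L u (c ∷ y)
  into-half {b ∷ y} u∉L with b ≟ᵇ c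
  ... | yes refl = y , u∉L , ε
  ... | no  b≢c  = subst (λ c′ → ∃ λ y′ → (c′ ∷ y′) ∉ L × Walk L (b ∷ y) (c′ ∷ y′))
                         (sym (¬-not (b≢c ∘ sym))) (reach u∉L)
... | y , cy∉L , u⇝cy | y′ , cy′∉L , v⇝cy′ =
  u⇝cy ◅◅ walk-slice c (half-connected (cy∉L ∘ ∈-slice⁻ c L) (cy′∉L ∘ ∈-slice⁻ c L))
       ◅◅ walk-reverse v⇝cy′

Crossable : ∀ {n} → List (QVertex (suc n)) → Bool → QVertex n → Set
Crossable L b x = (b ∷ x) ∉ L × (not b ∷ x) ∉ L

crossable? : ∀ {n} (L : List (QVertex (suc n))) b x → Dec (Crossable L b x)
crossable? L b x = ¬? ((b ∷ x) ∈? L) ×-dec ¬? ((not b ∷ x) ∈? L)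

cross-from : ∀ {n} {L : List (QVertex (suc n))} {b y} i →
             (b ∷ y) ∉ L → Crossable L b (flip i y) → Walk L (b ∷ y) (not b ∷ flip i y)
cross-from i by∉L (bx∉L , b̄x∉L) = flip-edge (fsuc i) by∉L bx∉L ◅ flip-edge fzero bx∉L b̄x∉L ◅ ε

Blocked : ∀ {n} → List (QVertex (suc n)) → QVertex n → Set
Blocked L x = ∃ λ c → (c ∷ x) ∈ L

¬crossable⇒blocked : ∀ {n} {L : List (QVertex (suc n))} {b x} → ¬ Crossable L b x → Blocked L x
¬crossable⇒blocked {L = L} {b} {x} ¬cr with (b ∷ x) ∈? L | (not b ∷ x) ∈? L
... | yes bx∈L | _        = b , bx∈L
... | no  _    | yes b̄x∈L = not b , b̄x∈L
... | no  bx∉L | no  b̄x∉L = ⊥-elim (¬cr (bx∉L , b̄x∉L))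

blocked-count : ∀ {n k} {L : List (QVertex (suc n))} (f : Fin k → QVertex n) →
                Injective _≡_ _≡_ f → (∀ i → Blocked L (f i)) → k ≤ length L
blocked-count f f-inj blocked =
  injection⇒≤length (λ i → proj₁ (blocked i) ∷ f i) (f-inj ∘ cong tail) (proj₂ ∘ blocked)

closed-neighbourhood : ∀ {n} → QVertex n → Fin (suc n) → QVertex n
closed-neighbourhood y fzero    = y
closed-neighbourhood y (fsuc i) = flip i y

closed-neighbourhood-injective : ∀ {n} (y : QVertex n) → Injective _≡_ _≡_ (closed-neighbourhood y)
closed-neighbourhood-injective y {fzero}  {fzero}   _ = refl
closed-neighbourhood-injective y {fsuc i} {fsuc i′} e = cong fsuc (flip-injective y e)
closed-neighbourhood-injective y {fzero}  {fsuc i′} e =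
  ⊥-elim (≢-by-distance y (hamming-refl y) (hamming-flip i′ y) (λ ()) e)
closed-neighbourhood-injective y {fsuc i} {fzero}   e =
  ⊥-elim (≢-by-distance y (hamming-flip i y) (hamming-refl y) (λ ()) e)

two-step-neighbourhood : ∀ {m} → QVertex (suc m) → Fin (suc m) → Fin (suc (suc m)) ⊎ Fin m → QVertex (suc m)
two-step-neighbourhood y j (inj₁ i) = closed-neighbourhood y i
two-step-neighbourhood y j (inj₂ l) = flip (punchIn j l) (flip j y)

closed-neighbourhood≢second-step : ∀ {m} (y : QVertex (suc m)) j i l →
                                   closed-neighbourhood y i ≢ flip (punchIn j l) (flip j y)
closed-neighbourhood≢second-step y j fzero    l =
  ≢-by-distance y (hamming-refl y) (hamming-flip-flip y (punchInᵢ≢i j l)) (λ ())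
closed-neighbourhood≢second-step y j (fsuc i) l =
  ≢-by-distance y (hamming-flip i y) (hamming-flip-flip y (punchInᵢ≢i j l)) (λ ())

two-step-neighbourhood-injective : ∀ {m} (y : QVertex (suc m)) j → Injective _≡_ _≡_ (two-step-neighbourhood y j)
two-step-neighbourhood-injective y j {inj₁ i} {inj₁ i′} e = cong inj₁ (closed-neighbourhood-injective y e)
two-step-neighbourhood-injective y j {inj₂ l} {inj₂ l′} e =
  cong inj₂ (punchIn-injective j l l′ (flip-injective (flip j y) e))
two-step-neighbourhood-injective y j {inj₁ i} {inj₂ l}  e = ⊥-elim (closed-neighbourhood≢second-step y j i l e)
two-step-neighbourhood-injective y j {inj₂ l} {inj₁ i}  e = ⊥-elim (closed-neighbourhood≢second-step y j i l (sym e))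

splitAt-injective : ∀ a {b} → Injective _≡_ _≡_ (splitAt a {b})
splitAt-injective a {b} {i} {i′} e = trans (sym (join-splitAt a b i)) (trans (cong (join a b) e) (join-splitAt a b i′))

reach-other-half : ∀ {n} {L : List (QVertex (suc n))} → length L ≤ n → ReachesOtherHalf L
reach-other-half {n} {L} |L|≤n {b} {y} by∉L with (not b ∷ y) ∈? L
... | no  b̄y∉L = y , b̄y∉L , flip-edge fzero by∉L b̄y∉L ◅ ε
... | yes b̄y∈L with any? (crossable? L b ∘ λ i → flip i y)
...   | yes (i , cr) = flip i y , proj₂ cr , cross-from i by∉L cr
...   | no  ¬cr      = ⊥-elim (<-irrefl refl (≤-trans counted |L|≤n))
  where
  counted : suc n ≤ length L
  counted = blocked-count (closed-neighbourhood y) (closed-neighbourhood-injective y) λ where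
    fzero    → not b , b̄y∈L
    (fsuc i) → ¬crossable⇒blocked (¬cr ∘ (i ,_))

few-deletions-connected : ∀ n {L : List (QVertex (suc n))} → length L ≤ n → Connected L
few-deletions-connected zero    {L} |L|≤0 = connected-by-halves false (connected-Q₀ _) (reach-other-half |L|≤0)
few-deletions-connected (suc n) {L} |L|≤n+1 with shorter-slice L (≤-<-trans |L|≤n+1 (m<m+n (suc n) z<s))
... | c , short = connected-by-halves c (few-deletions-connected n short) (reach-other-half |L|≤n+1)

NoIsolatedVertex : ∀ {n} → List (QVertex n) → Set
NoIsolatedVertex L = ∀ {w} → w ∉ L → ∃ λ i → flip i w ∉ L

reach-other-half-without-isolated : ∀ {m} {L : List (QVertex (suc (suc m)))} →
  length L < suc m + suc m → NoIsolatedVertex L → ReachesOtherHalf L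
reach-other-half-without-isolated {m} {L} |L|< no-isolated {b} {y} by∉L with (not b ∷ y) ∈? L
... | no  b̄y∉L = y , b̄y∉L , flip-edge fzero by∉L b̄y∉L ◅ ε
... | yes b̄y∈L with no-isolated by∉L
...   | fzero  , b̄y∉L = ⊥-elim (b̄y∉L b̄y∈L)
...   | fsuc j , bz∉L with any? (crossable? L b ∘ λ i → flip i y)
...     | yes (i , cr) = flip i y , proj₂ cr , cross-from i by∉L cr
...     | no  ¬cr₁ with any? (crossable? L b ∘ λ l → flip (punchIn j l) (flip j y))
...       | yes (l , cr) = _ , proj₂ cr , flip-edge (fsuc j) by∉L bz∉L ◅ cross-from (punchIn j l) bz∉L cr
...       | no  ¬cr₂ = ⊥-elim (<-irrefl refl (<-≤-trans |L|< (subst (_≤ length L) size counted)))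
  where
  size : suc (suc m) + m ≡ suc m + suc m
  size = cong suc (sym (+-suc m m))
  blocked : ∀ s → Blocked L (two-step-neighbourhood y j s)
  blocked (inj₁ fzero)    = not b , b̄y∈L
  blocked (inj₁ (fsuc i)) = ¬crossable⇒blocked (¬cr₁ ∘ (i ,_))
  blocked (inj₂ l)        = ¬crossable⇒blocked (¬cr₂ ∘ (l ,_))
  counted : suc (suc m) + m ≤ length L
  counted = blocked-count (two-step-neighbourhood y j ∘ splitAt (suc (suc m)))
    (splitAt-injective (suc (suc m)) ∘ two-step-neighbourhood-injective y j) (blocked ∘ splitAt (suc (suc m)))

connected-without-isolated : ∀ m {L : List (QVertex (suc (suc m)))} →
  length L < suc m + suc m → NoIsolatedVertex L → Connected L
connected-without-isolated m {L} |L|< no-isolated with shorter-slice L |L|<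
... | c , short = connected-by-halves c (few-deletions-connected m short) (reach-other-half-without-isolated |L|< no-isolated)

ceilDivSuc-ceiling : ∀ a b → a ≤ ceilDivSuc a b * suc b
ceilDivSuc-ceiling a b = +-cancelʳ-≤ b a _ (begin
  a + b                                     ≡⟨ m≡m%n+[m/n]*n (a + b) (suc b) ⟩
  (a + b) % suc b + ceilDivSuc a b * suc b  ≤⟨ +-monoˡ-≤ _ (≤-pred (m%n<n (a + b) (suc b))) ⟩
  b + ceilDivSuc a b * suc b                ≡⟨ +-comm b _ ⟩
  ceilDivSuc a b * suc b + b                ∎)
  where open ≤-Reasoning

<ceilDivSuc⇒*< : ∀ {x} a b → x < ceilDivSuc a b → x * suc b < a
<ceilDivSuc⇒*< {x} a b x< = +-cancelʳ-≤ b (suc (x * suc b)) a (begin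
  suc (x * suc b) + b     ≡⟨ cong suc (+-comm (x * suc b) b) ⟩
  suc x * suc b           ≤⟨ *-monoˡ-≤ (suc b) x< ⟩
  ceilDivSuc a b * suc b  ≤⟨ m/n*n≤m (a + b) (suc b) ⟩
  a + b                   ∎)
  where open ≤-Reasoning

*-double-suc : ∀ x j → x * suc (2 * j + 1) ≡ 2 * (x * suc j)
*-double-suc = solve-∀

small-cut-arithmetic : ∀ f j m → f * suc (2 * j + 1) < 2 * suc (suc m) →
                       f * suc j < suc (suc m) × f * (2 * j + 1) < suc m + suc m
small-cut-arithmetic zero    j m _ = z<s , z<s
small-cut-arithmetic (suc f) j m small = per-vertex , (begin-strict
  suc f * (2 * j + 1)          <⟨ m<n+m (suc f * (2 * j + 1)) {suc f} z<s ⟩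
  suc f + suc f * (2 * j + 1)  ≡⟨ *-suc (suc f) (2 * j + 1) ⟨
  suc f * suc (2 * j + 1)      ≡⟨ *-double-suc (suc f) j ⟩
  2 * (suc f * suc j)          ≤⟨ *-monoʳ-≤ 2 (≤-pred per-vertex) ⟩
  2 * suc m                    ≡⟨ cong (suc m +_) (+-identityʳ (suc m)) ⟩
  suc m + suc m                ∎)
  where
  open ≤-Reasoning
  per-vertex : suc f * suc j < suc (suc m)
  per-vertex = *-cancelˡ-< 2 _ _ (subst (_< 2 * suc (suc m)) (*-double-suc (suc f) j) small)

-- The lower bound

vertices : ∀ {n k} → List (CSub n k) → List (QVertex n)
vertices []      = []
vertices (T ∷ F) = tabulate (vert T) ++ vertices F

Removed⇒∈vertices : ∀ {n k} (F : List (CSub n k)) {v} → Removed F v → v ∈ vertices F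
Removed⇒∈vertices (T ∷ F) (_ , here refl , x , refl) = ∈-++⁺ˡ (∈-tabulate⁺ x)
Removed⇒∈vertices (T ∷ F) (T′ , there T′∈F , x , e) =
  ∈-++⁺ʳ (tabulate (vert T)) (Removed⇒∈vertices F (T′ , T′∈F , x , e))

∈vertices⇒Removed : ∀ {n k} (F : List (CSub n k)) {v} → v ∈ vertices F → Removed F v
∈vertices⇒Removed (T ∷ F) v∈ with ∈-++⁻ (tabulate (vert T)) v∈
... | inj₁ v∈T = let x , e = ∈-tabulate⁻ v∈T in T , here refl , x , sym e
... | inj₂ v∈F = let T′ , T′∈F , x , e = ∈vertices⇒Removed F v∈F in T′ , there T′∈F , x , e

length-vertices : ∀ {n k} (F : List (CSub n k)) → length (vertices F) ≤ length F * k
length-vertices []      = z≤n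
length-vertices (T ∷ F) = ≤-trans (≤-reflexive (length-++ (tabulate (vert T))))
  (+-mono-≤ (≤-trans (≤-reflexive (length-tabulate (vert T))) (injective⇒≤ (emb-inj T))) (length-vertices F))

-- Neighbours of w all lie at odd distance from w, so they form one colour class of T.
neighbour-index : ∀ {n j} (T : CSub n (2 * j + 1)) (w : QVertex n) →
  Σ (Fin (m T) → Fin (suc j)) λ ψ → ∀ {x y} → QAdj (vert T x) w → QAdj (vert T y) w → ψ x ≡ ψ y → x ≡ y
neighbour-index T w with colour-class-index T (λ x → parity (hamming (vert T x) w))
                                                (λ {x} {y} e → adjacent-parity (vert T x) (vert T y) w (edge-sub T x y e))
... | ψ , ψ-injective = ψ , λ xw yw → ψ-injective (trans (cong parity xw) (sym (cong parity yw)))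

neighbourhood-uncovered : ∀ {n j} (F : List (CSub n (2 * j + 1))) → length F * suc j < n →
                          ∀ w → ¬ (∀ i → Removed F (flip i w))
neighbourhood-uncovered {n} {j} F small w covered =
  <-irrefl refl (<-≤-trans small (injective⇒≤ {f = slot} slot-injective))
  where
  T : Fin n → CSub n (2 * j + 1)
  T i = proj₁ (covered i)
  T∈F : ∀ i → T i ∈ F
  T∈F i = proj₁ (proj₂ (covered i))
  x : ∀ i → Fin (m (T i))
  x i = proj₁ (proj₂ (proj₂ (covered i)))
  x≡flip : ∀ i → vert (T i) (x i) ≡ flip i w
  x≡flip i = proj₂ (proj₂ (proj₂ (covered i)))
  x~w : ∀ i → QAdj (vert (T i) (x i)) w
  x~w i = trans (cong (λ v → hamming v w) (x≡flip i)) (hamming-flip i w)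

  slot : Fin n → Fin (length F * suc j)
  slot i = combine (index (T∈F i)) (proj₁ (neighbour-index (T i) w) (x i))

  same-vertex : ∀ {T T′ : CSub n (2 * j + 1)} → T ≡ T′ →
                ∀ {y y′} → QAdj (vert T y) w → QAdj (vert T′ y′) w →
                proj₁ (neighbour-index T w) y ≡ proj₁ (neighbour-index T′ w) y′ → vert T y ≡ vert T′ y′
  same-vertex {T} refl yw y′w e = cong (vert T) (proj₂ (neighbour-index T w) yw y′w e)

  slot-injective : Injective _≡_ _≡_ slot
  slot-injective {i} {i′} e with combine-injective (index (T∈F i)) _ (index (T∈F i′)) _ e
  ... | same-index , same-ψ = flip-injective w (trans (sym (x≡flip i)) (trans
        (same-vertex (trans (lookup-index (T∈F i)) (trans (cong (lookup F) same-index) (sym (lookup-index (T∈F i′)))))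
                     (x~w i) (x~w i′) same-ψ) (x≡flip i′)))

vertices-no-isolated : ∀ {n j} (F : List (CSub n (2 * j + 1))) → length F * suc j < n → NoIsolatedVertex (vertices F)
vertices-no-isolated F small {w} _ with any? (λ i → ¬? (flip i w ∈? vertices F))
... | yes free-neighbour = free-neighbour
... | no  ¬free = ⊥-elim (neighbourhood-uncovered F small w λ i →
                    ∈vertices⇒Removed F (decidable-stable (flip i w ∈? vertices F) (¬free ∘ (i ,_))))

no-small-cut : ∀ {m j} (F : List (CSub (suc (suc m)) (2 * j + 1))) →
               length F * suc j < suc (suc m) → length F * (2 * j + 1) < suc m + suc m → ¬ IsCut F
no-small-cut {m} {j} F small few (inj₁ (u , v , u∉ , v∉ , ¬walk)) =
  ¬walk (gmap id (λ (u~v , u∉L , v∉L) → u~v , u∉L ∘ Removed⇒∈vertices F , v∉L ∘ Removed⇒∈vertices F)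
          (connected-without-isolated m (≤-<-trans (length-vertices F) few) (vertices-no-isolated {j = j} F small)
            (u∉ ∘ ∈vertices⇒Removed F) (v∉ ∘ ∈vertices⇒Removed F)))
no-small-cut {j = j} F small few (inj₂ (u , u∉ , only-u))
  with vertices-no-isolated {j = j} F small (u∉ ∘ ∈vertices⇒Removed F)
... | i , iu∉ = ≢-by-distance u (hamming-flip i u) (hamming-refl u) (λ ())
                  (only-u (flip i u) (iu∉ ∘ Removed⇒∈vertices F))

cut-length-lower-bound : ∀ m j (F : List (CSub (suc (suc m)) (2 * j + 1))) → IsCut F →
                         ceilDivSuc (2 * suc (suc m)) (2 * j + 1) ≤ length F
cut-length-lower-bound m j F cut = ≮⇒≥ λ small →
  let per-vertex , few = small-cut-arithmetic (length F) j m (<ceilDivSuc⇒*< (2 * suc (suc m)) (2 * j + 1) small)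
  in no-small-cut F per-vertex few cut

-- The upper bound

path-substructure : ∀ {n K} len → len ≤ K → (f : ℕ → QVertex n) →
  (∀ {r r′} → r < len → r′ < len → f r ≡ f r′ → r ≡ r′) →
  (∀ {r} → suc r < len → QAdj (f r) (f (suc r))) → CSub n K
path-substructure {n} {K} len len≤K f f-injective f-adjacent = record
  { m        = len
  ; vert     = f ∘ toℕ
  ; vert-inj = λ {i} {i′} e → toℕ-injective (f-injective (toℕ<n i) (toℕ<n i′) e)
  ; edge     = Consecutive
  ; edge-sub = λ i i′ e → subst (QAdj (f (toℕ i)) ∘ f) e (f-adjacent (subst (_< len) (sym e) (toℕ<n i′)))
  ; conn     = connected
  ; emb      = λ i → inject≤ i len≤K
  ; emb-inj  = λ {i} {i′} → inject≤-injective len≤K len≤K i i′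
  ; emb-hom  = λ i i′ e →
      inj₁ (inj₁ (trans (cong suc (toℕ-inject≤ i len≤K)) (trans e (sym (toℕ-inject≤ i′ len≤K)))))
  }
  where
  Consecutive : Fin len → Fin len → Set
  Consecutive i i′ = suc (toℕ i) ≡ toℕ i′

  from-first : ∀ t (t<len : t < len) → Star (SymClosure Consecutive) (fromℕ< (≤-<-trans z≤n t<len)) (fromℕ< t<len)
  from-first zero    _       = ε
  from-first (suc t) t+1<len = from-first t (<-trans (n<1+n t) t+1<len)
    ◅◅ fwd (trans (cong suc (toℕ-fromℕ< _)) (sym (toℕ-fromℕ< t+1<len))) ◅ ε

  connected : ∀ i i′ → Star (SymClosure Consecutive) i i′
  connected i i′ = reverse (symmetric Consecutive) (to i) ◅◅ to i′
    where
    to : ∀ i → Star (SymClosure Consecutive) (fromℕ< (≤-<-trans z≤n (toℕ<n i))) i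
    to i = subst (Star (SymClosure Consecutive) _) (fromℕ<-toℕ i (toℕ<n i)) (from-first (toℕ i) (toℕ<n i))

zeros : ∀ {n} → QVertex n
zeros = replicate _ false

ones : ∀ {n} → QVertex n
ones = replicate _ true

weight : ∀ {n} → QVertex n → ℕ
weight = hamming zeros

zeros≡ones⇒n≡0 : ∀ {n} → zeros {n} ≡ ones → n ≡ 0
zeros≡ones⇒n≡0 {zero}  _ = refl
zeros≡ones⇒n≡0 {suc n} ()

weight-ones : ∀ n → weight (ones {n}) ≡ n
weight-ones zero    = refl
weight-ones (suc n) = cong suc (weight-ones n)

-- zigzag (q + q) is the unit vector e_q and zigzag (suc (q + q)) is e_q + e_(q+1);
-- the arguments p with suc p < n + n give the path e_0, e_0 + e_1, e_1, …, e_(n-1) in Q_n.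
zigzag : ∀ {n} → ℕ → QVertex n
zigzag {zero}  _             = []
zigzag {suc n} zero          = true ∷ zeros
zigzag {suc n} (suc zero)    = true ∷ zigzag zero
zigzag {suc n} (suc (suc p)) = false ∷ zigzag p

zigzag-bound-step : ∀ {n p} → suc (suc (suc p)) < suc n + suc n → suc p < n + n
zigzag-bound-step {n} {p} h = ≤-pred (subst (suc (suc (suc p)) ≤_) (+-suc n n) (≤-pred h))

weight-zigzag : ∀ {n} p → suc p < n + n → weight (zigzag {n} p) ≡ 1 ⊎ weight (zigzag {n} p) ≡ 2
weight-zigzag {suc n}       zero          _ = inj₁ (cong suc (hamming-refl (zeros {n})))
weight-zigzag {suc (suc n)} (suc zero)    _ = inj₂ (cong (suc ∘ suc) (hamming-refl (zeros {n})))
weight-zigzag {suc n}       (suc (suc p)) h = weight-zigzag {n} p (zigzag-bound-step h)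
weight-zigzag {suc zero}    (suc zero)    (s≤s (s≤s ()))

zigzag-adjacent : ∀ {n} p → suc (suc p) < n + n → QAdj (zigzag {n} p) (zigzag (suc p))
zigzag-adjacent {suc (suc n)} zero          _ = cong suc (hamming-refl (zeros {n}))
zigzag-adjacent {suc n}       (suc zero)    _ = cong suc (hamming-refl (zigzag {n} zero))
zigzag-adjacent {suc n}       (suc (suc p)) h = zigzag-adjacent {n} p (zigzag-bound-step h)
zigzag-adjacent {suc zero}    zero          (s≤s (s≤s ()))

zigzag-injective : ∀ {n p p′} → suc p < n + n → suc p′ < n + n → zigzag {n} p ≡ zigzag p′ → p ≡ p′
zigzag-injective {suc n}       {zero}        {zero}         _ _ _ = refl
zigzag-injective {suc n}       {suc zero}    {suc zero}     _ _ _ = refl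
zigzag-injective {suc n}       {suc (suc p)} {suc (suc p′)} h h′ e =
  cong (suc ∘ suc) (zigzag-injective (zigzag-bound-step h) (zigzag-bound-step h′) (cong tail e))
zigzag-injective {suc (suc n)} {zero}        {suc zero}     _ _ ()
zigzag-injective {suc (suc n)} {suc zero}    {zero}         _ _ ()
zigzag-injective {suc zero}    {zero}        {suc zero}     _ (s≤s (s≤s ())) _
zigzag-injective {suc zero}    {suc zero}    {zero}         (s≤s (s≤s ())) _ _
zigzag-injective {suc n}       {zero}        {suc (suc p′)} _ _ ()
zigzag-injective {suc n}       {suc zero}    {suc (suc p′)} _ _ ()
zigzag-injective {suc n}       {suc (suc p)} {zero}         _ _ ()
zigzag-injective {suc n}       {suc (suc p)} {suc zero}     _ _ ()

zeros-neighbour : ∀ {n} (x : QVertex n) → QAdj zeros x → ∃ λ q → q < n × x ≡ zigzag (q + q)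
zeros-neighbour (true  ∷ x) h = 0 , z<s , cong (true ∷_) (sym (hamming≡0⇒≡ zeros x (suc-injective h)))
zeros-neighbour (false ∷ x) h with zeros-neighbour x h
... | q , q<n , x≡ = suc q , s≤s q<n , trans (cong (false ∷_) x≡) (cong (zigzag ∘ suc) (sym (+-suc q q)))

module ZigzagCut (n j : ℕ) where

  K c : ℕ
  K = 2 * j + 1
  c = ceilDivSuc (2 * n) K

  <∸⇒valid : ∀ {r s} → r < n + n ∸ suc s → suc (r + s) < n + n
  <∸⇒valid {r} {s} r< = subst (_≤ n + n) (cong suc (+-suc r s))
    (m≤o∸n⇒m+n≤o (suc r) (<⇒≤ (m∸n≢0⇒n<m {n + n} {suc s} λ e → n≮0 (subst (r <_) e r<))) r<)

  segment : ℕ → CSub n K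
  segment a = path-substructure (K ⊓ (n + n ∸ suc (a + a))) (m⊓n≤m _ _) (λ r → zigzag (r + (a + a)))
    (λ r< r′< e → +-cancelʳ-≡ (a + a) _ _ (zigzag-injective (valid r<) (valid r′<) e))
    (λ r+1< → zigzag-adjacent {n} _ (valid r+1<))
    where
    valid : ∀ {r} → r < K ⊓ (n + n ∸ suc (a + a)) → suc (r + (a + a)) < n + n
    valid r< = <∸⇒valid (<-≤-trans r< (m⊓n≤n _ _))

  cover : List (CSub n K)
  cover = tabulate λ (s : Fin c) → segment (toℕ s * suc j)

  removed-weight : ∀ {x} → Removed cover x → weight x ≡ 1 ⊎ weight x ≡ 2
  removed-weight (T , T∈ , i , refl) with ∈-tabulate⁻ T∈
  ... | s , refl = weight-zigzag {n} _ (<∸⇒valid (<-≤-trans (toℕ<n i) (m⊓n≤n _ _)))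

  n≤c*[j+1] : n ≤ c * suc j
  n≤c*[j+1] = *-cancelˡ-≤ 2 (≤-trans (ceilDivSuc-ceiling (2 * n) K) (≤-reflexive (*-double-suc c j)))

  -- e_q is vertex 2t of the segment starting at e_a, where q = a + t with t = q mod (j+1).
  unit-removed : ∀ {q} → q < n → Removed cover (zigzag (q + q))
  unit-removed {q} q<n = segment a , ∈-tabulate⁺ s , fromℕ< r<len , cong zigzag position
    where
    q/[j+1]<c : q / suc j < c
    q/[j+1]<c = m<n*o⇒m/o<n (<-≤-trans q<n n≤c*[j+1])
    s : Fin c
    s = fromℕ< q/[j+1]<c
    a t : ℕ
    a = toℕ s * suc j
    t = q % suc j
    q≡t+a : q ≡ t + a
    q≡t+a = trans (m≡m%n+[m/n]*n q (suc j)) (cong (λ u → t + u * suc j) (sym (toℕ-fromℕ< q/[j+1]<c)))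
    q+q≡ : q + q ≡ t + t + (a + a)
    q+q≡ = trans (cong₂ _+_ q≡t+a q≡t+a) (interchange t a t a)
    r<len : t + t < K ⊓ (n + n ∸ suc (a + a))
    r<len = ⊓-glb
      (≤-trans (s≤s (+-mono-≤ t≤j t≤j)) (≤-reflexive (sym (2*j+1≡1+[j+j] j))))
      (m+n≤o⇒m≤o∸n (suc (t + t)) (begin
        suc (t + t) + suc (a + a)  ≡⟨ cong suc (+-suc (t + t) (a + a)) ⟩
        suc (suc (t + t + (a + a))) ≡⟨ cong (suc ∘ suc) q+q≡ ⟨
        suc (suc (q + q))          ≡⟨ cong suc (+-suc q q) ⟨
        suc q + suc q              ≤⟨ +-mono-≤ q<n q<n ⟩
        n + n                      ∎))
      where
      open ≤-Reasoning
      t≤j : t ≤ j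
      t≤j = ≤-pred (m%n<n q (suc j))
    position : toℕ (fromℕ< r<len) + (a + a) ≡ q + q
    position = trans (cong (_+ (a + a)) (toℕ-fromℕ< r<len)) (sym q+q≡)

  walk-from-zeros : ∀ {v} → Star (RemAdj cover) zeros v → zeros ≡ v
  walk-from-zeros ε = refl
  walk-from-zeros (_◅_ {j = x} (0~x , _ , x∉) _) with zeros-neighbour x 0~x
  ... | q , q<n , refl = ⊥-elim (x∉ (unit-removed q<n))

  cover-cut : 3 ≤ n → IsCut cover
  cover-cut 3≤n = inj₁ (zeros , ones , zeros∉ , ones∉ ,
    λ w → n≮0 (≤-trans 3≤n (≤-reflexive (zeros≡ones⇒n≡0 (walk-from-zeros w)))))
    where
    zeros∉ : ¬ Removed cover zeros
    zeros∉ r with removed-weight r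
    ... | inj₁ e = 0≢1+n (trans (sym (hamming-refl (zeros {n}))) e)
    ... | inj₂ e = 0≢1+n (trans (sym (hamming-refl (zeros {n}))) e)
    ones∉ : ¬ Removed cover ones
    ones∉ r with removed-weight r | subst (3 ≤_) (sym (weight-ones n)) 3≤n
    ... | inj₁ e | 3≤w = ≤⇒≯ (≤-reflexive e) (<⇒≤ 3≤w)
    ... | inj₂ e | 3≤w = ≤⇒≯ (≤-reflexive e) 3≤w

lemma14 : ∀ (n k : ℕ) → 3 ≤ n → (∃ λ j → k ≡ 2 * j + 1) → 3 ≤ k → k ≤ 2 ^ (n ∸ 1) →
    KappaS≡ n k (ceilDivSuc (2 * n) k)
lemma14 n@(suc (suc m)) .(2 * j + 1) 3≤n@(s≤s (s≤s _)) (j , refl) _ _ =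
  (cover , cover-cut 3≤n , length-tabulate _) , cut-length-lower-bound m j
  where open ZigzagCut n j
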